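{- Let $G$ be a $(k,d_1,d)$-endblock $B(k,l)$ and let $t$ be the number of vertices of $G$ not on the boundary of the exceptional face. Then: if $(k,d_1,l)=(3,3,2)$ then $t=(5-d)/3$; if $(k,d_1,l)=(3,4,2)$ then $t=3$; if $(k,d_1,l)=(3,5,2)$ then $t=d+7$; if $(k,d_1,l)=(4,3,2)$ then $t=2$; if $(k,d_1,l)=(5,3,2)$ then $t=d+3$; if $(k,d_1,l)=(5,3,3)$ then $t=d+4$; if $(k,d_1,l)=(5,3,4)$ then $t=d+5$.
   Context: All graphs are finite and simple, considered with a fixed plane embedding; the degree of a face is the length of its boundary. A $(k,d_1,d)$-endblock $B(k,l)$ is a $2$-connected plane graph on $n$ vertices such that $n-1$ vertices have degree $k$, one exceptional vertex $x_1$ has degree $l$ with $1<l<k$, all faces but one have common degree $d_1$, the remaining (exceptional) face has degree $d\neq d_1$, and $x_1$ lies on the boundary of the exceptional face. -}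

module Defs where

open import Data.Nat using (ℕ; zero; suc; _+_; _*_; _≤_; _<_)
open import Data.Fin using (Fin; zero; suc)
open import Data.Fin.Properties using (any?)
open import Data.Product using (Σ; ∃; _×_; _,_)
open import Relation.Nullary using (¬_; Dec; yes; no; ¬?)
open import Relation.Nullary.Decidable using (_×-dec_)
open import Relation.Binary.PropositionalEquality using (_≡_; _≢_)
import Data.Fin as F

iter : {A : Set} → (A → A) → ℕ → A → A
iter f zero    x = x
iter f (suc k) x = f (iter f k x)

count : {m : ℕ} → (P : Fin m → Set) → ((i : Fin m) → Dec (P i)) → ℕ
count {zero}  P P? = 0
count {suc m} P P? with P? zero
... | yes _ = suc (count (λ i → P (suc i)) (λ i → P? (suc i)))
... | no  _ = count (λ i → P (suc i)) (λ i → P? (suc i))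

-- A plane graph, given by its combinatorial map (rotation system):
-- darts Fin m, α = fixed-point-free involution pairing the two darts of an
-- edge, σ = rotation (cyclic order of darts around each vertex), the faces
-- are the orbits of φ = σ ∘ α.  Vertices are labelled Fin n via 'tail'
-- (whose fibres are exactly the σ-orbits), faces are labelled Fin f via
-- 'face' (whose fibres are exactly the φ-orbits).  The embedding is in the
-- plane (sphere) iff Euler's formula n - m/2 + f = 2 holds (map connected).
record PlaneGraph : Set where
  field
    n m f : ℕ
    α σ   : Fin m → Fin m
    tail  : Fin m → Fin n
    face  : Fin m → Fin f
    α-invol   : ∀ d → α (α d) ≡ d
    α-nofix   : ∀ d → α d ≢ d
    σ-inj     : ∀ d e → σ d ≡ σ e → d ≡ e
    tail-σ    : ∀ d → tail (σ d) ≡ tail d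
    tail-orb  : ∀ d e → tail d ≡ tail e → ∃ λ k → iter σ k d ≡ e
    tail-surj : ∀ v → ∃ λ d → tail d ≡ v
    face-φ    : ∀ d → face (σ (α d)) ≡ face d
    face-orb  : ∀ d e → face d ≡ face e → ∃ λ k → iter (λ x → σ (α x)) k d ≡ e
    face-surj : ∀ F → ∃ λ d → face d ≡ F
    euler     : 2 * n + 2 * f ≡ m + 4
    noLoop    : ∀ d → tail (α d) ≢ tail d
    noMulti   : ∀ d e → tail d ≡ tail e → tail (α d) ≡ tail (α e) → d ≡ e

module _ (G : PlaneGraph) where
  open PlaneGraph G

  -- Reach v u w : there is a walk from u to w in G avoiding vertex v
  -- (u and w themselves assumed ≠ v by the user)
  data ReachAvoid (v : Fin n) : Fin n → Fin n → Set where
    here : ∀ {u} → ReachAvoid v u u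
    step : ∀ {w} (d : Fin m) → tail (α d) ≢ v →
           ReachAvoid v (tail (α d)) w → ReachAvoid v (tail d) w

  data Reach : Fin n → Fin n → Set where
    here : ∀ {u} → Reach u u
    step : ∀ {w} (d : Fin m) → Reach (tail (α d)) w → Reach (tail d) w

  Connected : Set
  Connected = ∀ u w → Reach u w

  TwoConnected : Set
  TwoConnected = 3 ≤ n × Connected ×
    (∀ v u w → u ≢ v → w ≢ v → ReachAvoid v u w)

  vdeg : Fin n → ℕ
  vdeg v = count (λ d → tail d ≡ v) (λ d → tail d F.≟ v)

  fdeg : Fin f → ℕ
  fdeg F = count (λ d → face d ≡ F) (λ d → face d F.≟ F)

  OnBoundary : Fin n → Fin f → Set
  OnBoundary v F = ∃ λ d → face d ≡ F × tail d ≡ v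

  onBoundary? : ∀ v F → Dec (OnBoundary v F)
  onBoundary? v F = any? (λ d → (face d F.≟ F) ×-dec (tail d F.≟ v))

  notOnBoundaryCount : Fin f → ℕ
  notOnBoundaryCount F = count (λ v → ¬ OnBoundary v F) (λ v → ¬? (onBoundary? v F))

  IsEndblock : (k d₁ d l : ℕ) → Fin n → Fin f → Set
  IsEndblock k d₁ d l x₁ Fe =
    TwoConnected ×
    (1 < l × l < k) ×
    vdeg x₁ ≡ l ×
    (∀ v → v ≢ x₁ → vdeg v ≡ k) ×
    fdeg Fe ≡ d ×
    (∀ F → F ≢ Fe → fdeg F ≡ d₁) ×
    d ≢ d₁ ×
    OnBoundary x₁ Fe

module Submission where

-- Counting the darts of the endblock by vertex degrees and by face degrees, and combining the
-- two counts with Euler's formula, gives in each case a linear relation between n and d; the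
-- count t = n - d then needs that the exceptional face of degree d has exactly d boundary
-- vertices, i.e. that a face of a 2-connected plane graph never visits a vertex twice.
--
-- If a face passes twice through a vertex v,
-- along darts a ≠ b, then composing σ with the transposition of a and b splits v into two
-- vertices and the face into two faces. The new map is still connected, because G - v is
-- connected and every dart at v is paired by α with a dart away from v, so it violates
-- Euler's inequality 2n + 2f ≤ m + 4 for connected maps. That inequality is proved by
-- building α up one transposition (d, α d) at a time: each transposition splits or merges
-- one cycle of σ composed with the transpositions so far, and it can merge two components
-- only while merging two cycles.

open import Defs
open import Data.Nat using (ℕ; zero; suc; _+_; _*_; _∸_; _≤_; _<_; z≤n; s≤s; NonZero)
open import Data.Nat.Properties
  using ( +-identityʳ; +-suc; +-comm; +-assoc; *-suc; *-identityʳ; +-mono-≤; +-monoʳ-≤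
        ; +-cancelʳ-≡; *-cancelˡ-≡; n<1+n; n≤1+n; m<1+n⇒m<n∨m≡n; m<n⇒m<1+n; m≤n⇒m≤1+n
        ; m+[n∸m]≡n; m∸n+n≡m; m∸n≤m; m<n⇒0<n∸m; ∸-monoʳ-<; m+1+n≰m; <⇒≤; ≮⇒≥; _<?_
        ; ≤-refl; ≤-trans; ≤-pred; ≤-reflexive; ≤-antisym; ≤-<-trans; <-asym; <-cmp
        ; +-0-commutativeMonoid; +-commutativeSemigroup; module ≤-Reasoning )
open import Data.Fin using (Fin; zero; suc; toℕ; fromℕ<; punchIn; punchOut)
open import Data.Fin.Properties
  using ( _≟_; any?; pigeonhole; injective⇒≤; 0≢1+n; ¬Fin0; suc-injective; toℕ-injective
        ; toℕ<n; toℕ-fromℕ<; punchOut-cong; punchOut-injective; punchOut-punchIn; punchInᵢ≢i )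
open import Data.Fin.Permutation using (permutation)
open import Data.Fin.Permutation.Components using (transpose; transpose-inverse)
open import Data.Product using (∃; _×_; _,_; proj₁; proj₂; uncurry)
open import Data.Sum using (_⊎_; inj₁; inj₂; [_,_]′)
open import Data.List using (List; []; _∷_; length)
open import Data.List.Relation.Unary.All as All using (All)
open import Data.Empty using (⊥; ⊥-elim)
open import Function.Base using (_∘_)
open import Function.Definitions using (Injective)
open import Relation.Nullary using (¬_; Dec; yes; no; ¬?)
open import Relation.Nullary.Decidable using (_⊎-dec_; _×-dec_)
open import Relation.Unary using (Decidable)
open import Relation.Binary.Definitions using (tri<; tri≈; tri>)
open import Relation.Binary.PropositionalEquality
open import Algebra.Properties.CommutativeMonoid.Sum +-0-commutativeMonoid
  using (sum; sum-cong-≗; ∑-distrib-+; ∑-comm; sum-permute)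
open import Algebra.Properties.CommutativeSemigroup +-commutativeSemigroup using (x∙yz≈y∙xz)
open import Data.Nat.Tactic.RingSolver using (solve-∀; solve)

-- Orbits of a permutation of Fin m

iter-+ : ∀ {A : Set} (f : A → A) j k x → iter f (j + k) x ≡ iter f j (iter f k x)
iter-+ f zero    k x = refl
iter-+ f (suc j) k x = cong f (iter-+ f j k x)

iter-cong : ∀ {A : Set} {f g : A → A} → f ≗ g → ∀ k x → iter f k x ≡ iter g k x
iter-cong f≗g zero    x = refl
iter-cong {f = f} f≗g (suc k) x = trans (cong f (iter-cong f≗g k x)) (f≗g _)

iter-invariant : ∀ {A B : Set} {f : A → A} (L : A → B) →
                 (∀ x → L (f x) ≡ L x) → ∀ k x → L (iter f k x) ≡ L x
iter-invariant L inv zero    x = refl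
iter-invariant L inv (suc k) x = trans (inv _) (iter-invariant L inv k x)

iter-injective : ∀ {A : Set} {f : A → A} → Injective _≡_ _≡_ f →
                 ∀ k {x y} → iter f k x ≡ iter f k y → x ≡ y
iter-injective inj zero    eq = eq
iter-injective inj (suc k) eq = iter-injective inj k (inj eq)

iter-∸ : ∀ {A : Set} (f : A → A) {r k} x → r ≤ k → iter f (k ∸ r) (iter f r x) ≡ iter f k x
iter-∸ f {r} {k} x r≤k = trans (sym (iter-+ f (k ∸ r) r x)) (cong (λ j → iter f j x) (m∸n+n≡m r≤k))

iter-periodic : ∀ {A : Set} (f : A → A) p x → iter f p x ≡ x → ∀ q → iter f (q * p) x ≡ x
iter-periodic f p x fix zero    = refl
iter-periodic f p x fix (suc q) =
  trans (iter-+ f p (q * p) x) (trans (cong (iter f p) (iter-periodic f p x fix q)) fix)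

minimal-witness : (P : ℕ → Set) → Decidable P → ∀ {n} → P n →
                  ∃ λ r → P r × (∀ i → i < r → ¬ P i)
minimal-witness P P? {n} pn = search 0 n (λ _ ()) pn
  where
  search : ∀ j fuel → (∀ i → i < j → ¬ P i) → P (j + fuel) →
           ∃ λ r → P r × (∀ i → i < r → ¬ P i)
  search j fuel below p with P? j
  ... | yes pj = j , pj , below
  search j zero below p | no ¬pj = ⊥-elim (¬pj (subst P (+-identityʳ j) p))
  search j (suc fuel) below p | no ¬pj = search (suc j) fuel below′ (subst P (+-suc j fuel) p)
    where
    below′ : ∀ i → i < suc j → ¬ P i
    below′ i i<1+j with m<1+n⇒m<n∨m≡n i<1+j
    ... | inj₁ i<j  = below i i<j
    ... | inj₂ refl = ¬pj

SameOrbit : ∀ {A : Set} → (A → A) → A → A → Set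
SameOrbit f x y = ∃ λ k → iter f k x ≡ y

module _ {A : Set} {f : A → A} where

  sameOrbit-step : ∀ {x} → SameOrbit f x (f x)
  sameOrbit-step = 1 , refl

  sameOrbit-trans : ∀ {x y z} → SameOrbit f x y → SameOrbit f y z → SameOrbit f x z
  sameOrbit-trans {x} (j , p) (k , q) = k + j , trans (iter-+ f k j x) (trans (cong (iter f k) p) q)

  sameOrbit-invariant : ∀ {B : Set} (L : A → B) → (∀ x → L (f x) ≡ L x) →
                        ∀ {x y} → SameOrbit f x y → L x ≡ L y
  sameOrbit-invariant L inv {x} (k , eq) = trans (sym (iter-invariant L inv k x)) (cong L eq)

  sameOrbit-≗ : ∀ {g : A → A} → f ≗ g → ∀ {x y} → SameOrbit f x y → SameOrbit g x y
  sameOrbit-≗ f≗g {x} (k , eq) = k , trans (sym (iter-cong f≗g k x)) eq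

module _ {m} {π : Fin m → Fin m} (π-inj : Injective _≡_ _≡_ π) where

  -- Pigeonhole on the m + 1 points x, π x, …, πᵐ x.
  orbit-returns : ∀ x → ∃ λ p → iter π (suc p) x ≡ x
  orbit-returns x with pigeonhole (n<1+n m) (λ i → iter π (toℕ i) x)
  ... | i , j , i<j , eq = returns (m<n⇒0<n∸m i<j) (sym (iter-injective π-inj (toℕ i) eq′))
    where
    eq′ : iter π (toℕ i) x ≡ iter π (toℕ i) (iter π (toℕ j ∸ toℕ i) x)
    eq′ = trans eq (trans (cong (λ k → iter π k x) (sym (m+[n∸m]≡n (<⇒≤ i<j))))
                          (iter-+ π (toℕ i) _ x))
    returns : ∀ {d} → 0 < d → iter π d x ≡ x → ∃ λ p → iter π (suc p) x ≡ x
    returns {suc p} _ ret = p , ret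

  sameOrbit-positive : ∀ {x y} → SameOrbit π x y → ∃ λ k → iter π (suc k) x ≡ y
  sameOrbit-positive (suc k , eq)      = k , eq
  sameOrbit-positive {x} (zero , refl) = orbit-returns x

  sameOrbit-sym : ∀ {x y} → SameOrbit π x y → SameOrbit π y x
  sameOrbit-sym {x} (k , refl) with orbit-returns x
  ... | p , ret = k * p , (begin
    iter π (k * p) (iter π k x)  ≡⟨ iter-+ π (k * p) k x ⟨
    iter π (k * p + k) x        ≡⟨ cong (λ j → iter π j x) (trans (+-comm (k * p) k) (sym (*-suc k p))) ⟩
    iter π (k * suc p) x        ≡⟨ iter-periodic π (suc p) x ret k ⟩
    x                           ∎)
    where open ≡-Reasoning

record OrbitLabelling {m} (π : Fin m → Fin m) (c : ℕ) : Set where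
  field
    label            : Fin m → Fin c
    label-surjective : ∀ i → ∃ λ d → label d ≡ i
    label-invariant  : ∀ d → label (π d) ≡ label d
    label-complete   : ∀ {d e} → label d ≡ label e → SameOrbit π d e

  label-sameOrbit : ∀ {d e} → SameOrbit π d e → label d ≡ label e
  label-sameOrbit = sameOrbit-invariant label label-invariant

module _ {m} {π : Fin m → Fin m} where

  orbitCount-≤ : ∀ {c c′} → OrbitLabelling π c → OrbitLabelling π c′ → c ≤ c′
  orbitCount-≤ O O′ = injective⇒≤ {f = λ i → O′.label (representative i)} injective
    where
    module O  = OrbitLabelling O
    module O′ = OrbitLabelling O′
    representative : _ → Fin m
    representative i = proj₁ (O.label-surjective i)
    injective : ∀ {i j} → O′.label (representative i) ≡ O′.label (representative j) → i ≡ j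
    injective {i} {j} eq with O.label-surjective i | O.label-surjective j
    ... | d , refl | e , refl = O.label-sameOrbit (O′.label-complete eq)

  orbitCount-unique : ∀ {c c′} → OrbitLabelling π c → OrbitLabelling π c′ → c ≡ c′
  orbitCount-unique O O′ = ≤-antisym (orbitCount-≤ O O′) (orbitCount-≤ O′ O)

  orbitLabelling-≗ : ∀ {ρ c} → π ≗ ρ → OrbitLabelling π c → OrbitLabelling ρ c
  orbitLabelling-≗ π≗ρ O = record
    { label            = label
    ; label-surjective = label-surjective
    ; label-invariant  = λ d → trans (cong label (sym (π≗ρ d))) (label-invariant d)
    ; label-complete   = λ eq → sameOrbit-≗ π≗ρ (label-complete eq)
    }
    where open OrbitLabelling O

data TransposeView {m} (i j k : Fin m) : Fin m → Set where
  at-i  : k ≡ i → TransposeView i j k j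
  at-j  : k ≡ j → TransposeView i j k i
  fixed : k ≢ i → k ≢ j → TransposeView i j k k

transpose-view : ∀ {m} (i j k : Fin m) → TransposeView i j k (transpose i j k)
transpose-view i j k with k ≟ i
... | yes k≡i = at-i k≡i
... | no  k≢i with k ≟ j
...   | yes k≡j = at-j k≡j
...   | no  k≢j = fixed k≢i k≢j

transpose-i : ∀ {m} (i j : Fin m) → transpose i j i ≡ j
transpose-i i j with transpose i j i | transpose-view i j i
... | _ | at-i _      = refl
... | _ | at-j refl   = refl
... | _ | fixed i≢i _ = ⊥-elim (i≢i refl)

transpose-j : ∀ {m} (i j : Fin m) → transpose i j j ≡ i
transpose-j i j with transpose i j j | transpose-view i j j
... | _ | at-i refl   = refl
... | _ | at-j _      = refl
... | _ | fixed _ j≢j = ⊥-elim (j≢j refl)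

transpose-fixed : ∀ {m} (i j : Fin m) {k} → k ≢ i → k ≢ j → transpose i j k ≡ k
transpose-fixed i j {k} k≢i k≢j with transpose i j k | transpose-view i j k
... | _ | at-i k≡i  = ⊥-elim (k≢i k≡i)
... | _ | at-j k≡j  = ⊥-elim (k≢j k≡j)
... | _ | fixed _ _ = refl

transpose-comm : ∀ {m} (i j k : Fin m) → transpose i j k ≡ transpose j i k
transpose-comm i j k with transpose i j k | transpose-view i j k
... | _ | at-i refl     = sym (transpose-j j i)
... | _ | at-j refl     = sym (transpose-i j i)
... | _ | fixed k≢i k≢j = sym (transpose-fixed j i k≢j k≢i)

transpose-involutive : ∀ {m} (i j k : Fin m) → transpose i j (transpose i j k) ≡ k
transpose-involutive i j k = trans (cong (transpose i j) (transpose-comm i j k)) (transpose-inverse i j)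

transpose-injective : ∀ {m} (i j : Fin m) → Injective _≡_ _≡_ (transpose i j)
transpose-injective i j {k} {l} eq =
  trans (sym (transpose-involutive i j k)) (trans (cong (transpose i j) eq) (transpose-involutive i j l))

transpose-invariant : ∀ {m} {B : Set} (L : Fin m → B) {i j} → L i ≡ L j → ∀ k → L (transpose i j k) ≡ L k
transpose-invariant L {i} {j} Li≡Lj k with transpose i j k | transpose-view i j k
... | _ | at-i refl   = sym Li≡Lj
... | _ | at-j refl   = Li≡Lj
... | _ | fixed _ _   = refl

transpose-conjugate : ∀ {m} {f : Fin m → Fin m} → Injective _≡_ _≡_ f →
                      ∀ i j k → f (transpose i j k) ≡ transpose (f i) (f j) (f k)
transpose-conjugate {f = f} f-inj i j k with transpose i j k | transpose-view i j k
... | _ | at-i refl     = sym (transpose-i (f i) (f j))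
... | _ | at-j refl     = sym (transpose-j (f i) (f j))
... | _ | fixed k≢i k≢j = sym (transpose-fixed (f i) (f j) (k≢i ∘ f-inj) (k≢j ∘ f-inj))

-- Cycles of a permutation composed with a transposition

module Fuse {K} {i j : Fin (suc K)} (i≢j : i ≢ j) where

  redirect : Fin (suc K) → Fin (suc K)
  redirect k with k ≟ j
  ... | yes _ = i
  ... | no  _ = k

  redirect-cases : ∀ k → (k ≡ j × redirect k ≡ i) ⊎ (k ≢ j × redirect k ≡ k)
  redirect-cases k with k ≟ j
  ... | yes k≡j = inj₁ (k≡j , refl)
  ... | no  k≢j = inj₂ (k≢j , refl)

  redirect-misses-j : ∀ k → j ≢ redirect k
  redirect-misses-j k with redirect-cases k
  ... | inj₁ (_ , eq)   = λ j≡rk → i≢j (sym (trans j≡rk eq))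
  ... | inj₂ (k≢j , eq) = λ j≡rk → k≢j (sym (trans j≡rk eq))

  fuse : Fin (suc K) → Fin K
  fuse k = punchOut (redirect-misses-j k)

  fuse-identifies : fuse i ≡ fuse j
  fuse-identifies with redirect-cases i | redirect-cases j
  ... | inj₁ (i≡j , _) | _               = ⊥-elim (i≢j i≡j)
  ... | _              | inj₂ (j≢j , _)  = ⊥-elim (j≢j refl)
  ... | inj₂ (_ , ri) | inj₁ (_ , rj)    = punchOut-cong j (trans ri (sym rj))

  fuse-surjective : ∀ l → ∃ λ k → fuse k ≡ l
  fuse-surjective l with redirect-cases (punchIn j l)
  ... | inj₁ (eq , _) = ⊥-elim (punchInᵢ≢i j l eq)
  ... | inj₂ (_ , eq) = punchIn j l , trans (punchOut-cong j eq) (punchOut-punchIn j)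

  Fused : Fin (suc K) → Set
  Fused k = k ≡ i ⊎ k ≡ j

  fuse-injective : ∀ {k l} → fuse k ≡ fuse l → k ≡ l ⊎ (Fused k × Fused l)
  fuse-injective {k} {l} eq
    with redirect-cases k | redirect-cases l
       | punchOut-injective (redirect-misses-j k) (redirect-misses-j l) eq
  ... | inj₁ (k≡j , _)  | inj₁ (l≡j , _)  | _   = inj₂ (inj₂ k≡j , inj₂ l≡j)
  ... | inj₁ (k≡j , rk) | inj₂ (_ , rl)   | r≡r = inj₂ (inj₂ k≡j , inj₁ (trans (sym rl) (trans (sym r≡r) rk)))
  ... | inj₂ (_ , rk)   | inj₁ (l≡j , rl) | r≡r = inj₂ (inj₁ (trans (sym rk) (trans r≡r rl)) , inj₂ l≡j)
  ... | inj₂ (_ , rk)   | inj₂ (_ , rl)   | r≡r = inj₁ (trans (sym rk) (trans r≡r rl))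

module Transposed {m} (π : Fin m → Fin m) (π-inj : Injective _≡_ _≡_ π) (a b : Fin m) where

  π′ : Fin m → Fin m
  π′ x = transpose a b (π x)

  π′-injective : Injective _≡_ _≡_ π′
  π′-injective = π-inj ∘ transpose-injective a b

  Avoids : Fin m → ℕ → Set
  Avoids x k = ∀ j → j < k → iter π (suc j) x ≢ a × iter π (suc j) x ≢ b

  iter-avoiding : ∀ k x → Avoids x k → iter π′ k x ≡ iter π k x
  iter-avoiding zero    x _  = refl
  iter-avoiding (suc k) x av =
    trans (cong π′ (iter-avoiding k x (λ j j<k → av j (m<n⇒m<1+n j<k))))
          (uncurry (transpose-fixed a b) (av k (n<1+n k)))

  sameOrbit-avoiding : ∀ {B : Set} (L : Fin m → B) → (∀ x → L (π x) ≡ L x) →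
                       ∀ {x y} → L x ≢ L a → L x ≢ L b → SameOrbit π x y → SameOrbit π′ x y
  sameOrbit-avoiding L inv {x} x≁a x≁b (k , eq) = k , trans (iter-avoiding k x avoids) eq
    where
    avoids : Avoids x k
    avoids j _ = (λ e → x≁a (sameOrbit-invariant L inv (suc j , e)))
               , (λ e → x≁b (sameOrbit-invariant L inv (suc j , e)))

  -- Walk along π from z to its first return to a: π′ turns that last step into a step to b.
  reaches-b : ∀ {z} → (∀ j → iter π j z ≢ b) → SameOrbit π z a → SameOrbit π′ z b
  reaches-b {z} avoids-b z↝a with sameOrbit-positive π-inj z↝a
  ... | k , returns
    with minimal-witness (λ i → iter π (suc i) z ≡ a) (λ i → iter π (suc i) z ≟ a) {k} returns
  ...   | r , hits , first =
    suc r , trans (cong π′ (iter-avoiding r z avoids)) (trans (cong (transpose a b) hits) (transpose-i a b))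
    where
    avoids : Avoids z r
    avoids j j<r = first j j<r , avoids-b (suc j)

  -- The walk a, π a, … up to its first visit of b is a whole cycle of π′.
  module Arc (a≢b : a ≢ b) (a↝b : SameOrbit π a b) where

    private
      first-b : ∃ λ r → iter π r a ≡ b × (∀ i → i < r → iter π i a ≢ b)
      first-b = minimal-witness (λ i → iter π i a ≡ b) (λ i → iter π i a ≟ b) {proj₁ a↝b} (proj₂ a↝b)

    r : ℕ
    r = proj₁ first-b

    hits-b : iter π r a ≡ b
    hits-b = proj₁ (proj₂ first-b)

    before-b : ∀ i → i < r → iter π i a ≢ b
    before-b = proj₂ (proj₂ first-b)

    0<r : 0 < r
    0<r with r | hits-b
    ... | zero  | a≡b = ⊥-elim (a≢b a≡b)
    ... | suc _ | _   = s≤s z≤n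

    InArc : Fin m → Set
    InArc x = ∃ λ (i : Fin r) → iter π (toℕ i) a ≡ x

    inArc? : ∀ x → Dec (InArc x)
    inArc? x = any? (λ i → iter π (toℕ i) a ≟ x)

    no-early-return : ∀ j → 0 < j → j < r → iter π j a ≢ a
    no-early-return j 0<j j<r aʲ≡a = before-b (r ∸ j) (∸-monoʳ-< 0<j (<⇒≤ j<r))
      (trans (cong (iter π (r ∸ j)) (sym aʲ≡a)) (trans (iter-∸ π a (<⇒≤ j<r)) hits-b))

    walk-agrees : ∀ j → j < r → iter π′ j a ≡ iter π j a
    walk-agrees j j<r = iter-avoiding j a λ i i<j →
      no-early-return (suc i) (s≤s z≤n) (≤-<-trans i<j j<r) , before-b (suc i) (≤-<-trans i<j j<r)

    walk-closes : iter π′ r a ≡ a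
    walk-closes = closes r refl
      where
      closes : ∀ k → k ≡ r → iter π′ k a ≡ a
      closes zero    0≡r   = ⊥-elim (a≢b (subst (λ k → iter π k a ≡ b) (sym 0≡r) hits-b))
      closes (suc k) 1+k≡r = begin
        π′ (iter π′ k a)              ≡⟨ cong π′ (walk-agrees k (subst (k <_) 1+k≡r (n<1+n k))) ⟩
        transpose a b (iter π (suc k) a) ≡⟨ cong (λ j → transpose a b (iter π j a)) 1+k≡r ⟩
        transpose a b (iter π r a)    ≡⟨ cong (transpose a b) hits-b ⟩
        transpose a b b               ≡⟨ transpose-j a b ⟩
        a                             ∎
        where open ≡-Reasoning

    a∈arc : InArc a
    a∈arc = fromℕ< 0<r , cong (λ j → iter π j a) (toℕ-fromℕ< 0<r)

    b∉arc : ¬ InArc b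
    b∉arc (i , eq) = before-b (toℕ i) (toℕ<n i) eq

    arc-⊆-orbit-π : ∀ {x} → InArc x → SameOrbit π a x
    arc-⊆-orbit-π (i , eq) = toℕ i , eq

    arc-⊆-orbit : ∀ {x} → InArc x → SameOrbit π′ a x
    arc-⊆-orbit (i , eq) = toℕ i , trans (walk-agrees (toℕ i) (toℕ<n i)) eq

    arc-closed : ∀ {x} → InArc x → InArc (π′ x)
    arc-closed {x} (i , refl) with m<1+n⇒m<n∨m≡n (s≤s (toℕ<n i))
    ... | inj₁ 1+i<r = fromℕ< 1+i<r , (begin
      iter π (toℕ (fromℕ< 1+i<r)) a ≡⟨ cong (λ j → iter π j a) (toℕ-fromℕ< 1+i<r) ⟩
      iter π (suc (toℕ i)) a        ≡⟨ walk-agrees (suc (toℕ i)) 1+i<r ⟨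
      π′ (iter π′ (toℕ i) a)        ≡⟨ cong π′ (walk-agrees (toℕ i) (toℕ<n i)) ⟩
      π′ (iter π (toℕ i) a)         ∎)
      where open ≡-Reasoning
    ... | inj₂ 1+i≡r = subst InArc (sym closes) a∈arc
      where
      closes : π′ (iter π (toℕ i) a) ≡ a
      closes = trans (cong π′ (sym (walk-agrees (toℕ i) (toℕ<n i))))
                     (trans (cong (λ j → iter π′ j a) 1+i≡r) walk-closes)

    orbit-⊆-arc : ∀ {x} → SameOrbit π′ a x → InArc x
    orbit-⊆-arc (k , refl) = walk k
      where
      walk : ∀ k → InArc (iter π′ k a)
      walk zero    = a∈arc
      walk (suc k) = arc-closed (walk k)

module Split {m} (π : Fin m → Fin m) (π-inj : Injective _≡_ _≡_ π) {c} (O : OrbitLabelling π c)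
             {a b} (a≢b : a ≢ b) (same-orbit : OrbitLabelling.label O a ≡ OrbitLabelling.label O b) where
  open OrbitLabelling O
  open Transposed π π-inj a b

  module A = Arc a≢b (label-complete same-orbit)
  module B = Transposed.Arc π π-inj b a (a≢b ∘ sym) (label-complete (sym same-orbit))

  arcB-⊆-orbit : ∀ {x} → B.InArc x → SameOrbit π′ b x
  arcB-⊆-orbit p = sameOrbit-≗ (λ x → transpose-comm b a (π x)) (B.arc-⊆-orbit p)

  orbit-⊆-arcs : ∀ {x} → SameOrbit π a x → A.InArc x ⊎ B.InArc x
  orbit-⊆-arcs {x} (k , eq)
    with minimal-witness (λ i → iter π i a ≡ x) (λ i → iter π i a ≟ x) {k} eq
  ... | k₀ , hit , first with k₀ <? A.r
  ...   | yes k₀<r = inj₁ (fromℕ< k₀<r , trans (cong (λ j → iter π j a) (toℕ-fromℕ< k₀<r)) hit)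
  ...   | no  k₀≮r with k₀ ∸ A.r <? B.r
  ...     | yes k₁<r = inj₂ (fromℕ< k₁<r , trans (cong (λ j → iter π j b) (toℕ-fromℕ< k₁<r)) from-b)
    where
    from-b : iter π (k₀ ∸ A.r) b ≡ x
    from-b = trans (cong (iter π (k₀ ∸ A.r)) (sym A.hits-b)) (trans (iter-∸ π a (≮⇒≥ k₀≮r)) hit)
  ...     | no  k₁≮r = ⊥-elim (first (k₀ ∸ A.r ∸ B.r) shorter again)
    where
    shorter : k₀ ∸ A.r ∸ B.r < k₀
    shorter = ≤-<-trans (m∸n≤m (k₀ ∸ A.r) B.r) (∸-monoʳ-< {k₀} {A.r} {0} A.0<r (≮⇒≥ k₀≮r))
    again : iter π (k₀ ∸ A.r ∸ B.r) a ≡ x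
    again = begin
      iter π (k₀ ∸ A.r ∸ B.r) a                      ≡⟨ cong (iter π (k₀ ∸ A.r ∸ B.r)) B.hits-b ⟨
      iter π (k₀ ∸ A.r ∸ B.r) (iter π B.r b)         ≡⟨ iter-∸ π b (≮⇒≥ k₁≮r) ⟩
      iter π (k₀ ∸ A.r) b                            ≡⟨ cong (iter π (k₀ ∸ A.r)) A.hits-b ⟨
      iter π (k₀ ∸ A.r) (iter π A.r a)               ≡⟨ iter-∸ π a (≮⇒≥ k₀≮r) ⟩
      iter π k₀ a                                    ≡⟨ hit ⟩
      x                                              ∎
      where open ≡-Reasoning

  label′ : Fin m → Fin (suc c)
  label′ x with A.inArc? x
  ... | yes _ = zero
  ... | no  _ = suc (label x)

  label′-arc : ∀ {x} → A.InArc x → label′ x ≡ zero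
  label′-arc {x} x∈A with A.inArc? x
  ... | yes _   = refl
  ... | no  x∉A = ⊥-elim (x∉A x∈A)

  label′-off-arc : ∀ {x} → ¬ A.InArc x → label′ x ≡ suc (label x)
  label′-off-arc {x} x∉A with A.inArc? x
  ... | yes x∈A = ⊥-elim (x∉A x∈A)
  ... | no  _   = refl

  label′-surjective : ∀ i → ∃ λ d → label′ d ≡ i
  label′-surjective zero = a , label′-arc A.a∈arc
  label′-surjective (suc i) with label-surjective i
  ... | d , refl with A.inArc? d
  ...   | no  d∉A = d , label′-off-arc d∉A
  ...   | yes d∈A = b , trans (label′-off-arc A.b∉arc)
                              (cong suc (trans (sym same-orbit) (label-sameOrbit (A.arc-⊆-orbit-π d∈A))))

  label′-invariant : ∀ x → label′ (π′ x) ≡ label′ x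
  label′-invariant x with A.inArc? x
  ... | yes x∈A = label′-arc (A.arc-closed x∈A)
  ... | no  x∉A = trans (label′-off-arc π′x∉A)
                        (cong suc (trans (transpose-invariant label same-orbit (π x)) (label-invariant x)))
    where
    π′x∉A : ¬ A.InArc (π′ x)
    π′x∉A π′x∈A = x∉A (A.orbit-⊆-arc (sameOrbit-trans (A.arc-⊆-orbit π′x∈A)
                                                      (sameOrbit-sym π′-injective sameOrbit-step)))

  label′-complete : ∀ {x y} → label′ x ≡ label′ y → SameOrbit π′ x y
  label′-complete {x} {y} eq with A.inArc? x | A.inArc? y
  ... | yes x∈A | yes y∈A = sameOrbit-trans (sameOrbit-sym π′-injective (A.arc-⊆-orbit x∈A)) (A.arc-⊆-orbit y∈A)
  ... | yes _   | no  _   = ⊥-elim (0≢1+n eq)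
  ... | no  _   | yes _   = ⊥-elim (0≢1+n (sym eq))
  ... | no  x∉A | no  y∉A with suc-injective eq | label x ≟ label a
  ...   | lx≡ly | yes lx≡la = sameOrbit-trans (sameOrbit-sym π′-injective (in-B x∉A lx≡la))
                                              (in-B y∉A (trans (sym lx≡ly) lx≡la))
    where
    in-B : ∀ {z} → ¬ A.InArc z → label z ≡ label a → SameOrbit π′ b z
    in-B {z} z∉A lz≡la with orbit-⊆-arcs (label-complete (sym lz≡la))
    ... | inj₁ z∈A = ⊥-elim (z∉A z∈A)
    ... | inj₂ z∈B = arcB-⊆-orbit z∈B
  ...   | lx≡ly | no lx≢la =
    sameOrbit-avoiding label label-invariant lx≢la (λ lx≡lb → lx≢la (trans lx≡lb (sym same-orbit)))
                       (label-complete lx≡ly)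

  orbitLabelling : OrbitLabelling π′ (suc c)
  orbitLabelling = record
    { label            = label′
    ; label-surjective = label′-surjective
    ; label-invariant  = label′-invariant
    ; label-complete   = label′-complete
    }

module Merge {m} (π : Fin m → Fin m) (π-inj : Injective _≡_ _≡_ π) {c} (O : OrbitLabelling π (suc c))
             {a b} (apart : OrbitLabelling.label O a ≢ OrbitLabelling.label O b) where
  open OrbitLabelling O
  open Transposed π π-inj a b
  open Fuse apart

  never-hits : ∀ {z w} → label z ≢ label w → ∀ j → iter π j z ≢ w
  never-hits lz≢lw j eq = lz≢lw (label-sameOrbit (j , eq))

  reaches-b-fused : ∀ {z} → Fused (label z) → SameOrbit π′ z b
  reaches-b-fused (inj₁ lz≡la) = reaches-b (never-hits (λ lz≡lb → apart (trans (sym lz≡la) lz≡lb)))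
                                           (label-complete lz≡la)
  reaches-b-fused (inj₂ lz≡lb) = sameOrbit-trans z↝a (reaches-b-fused (inj₁ refl))
    where
    z↝a = sameOrbit-≗ (λ x → transpose-comm b a (π x))
            (Transposed.reaches-b π π-inj b a (never-hits (λ lz≡la → apart (trans (sym lz≡la) lz≡lb)))
                                  (label-complete lz≡lb))

  fused-sameOrbit : ∀ {x y} → Fused (label x) → Fused (label y) → SameOrbit π′ x y
  fused-sameOrbit fx fy = sameOrbit-trans (reaches-b-fused fx) (sameOrbit-sym π′-injective (reaches-b-fused fy))

  label′ : Fin m → Fin c
  label′ x = fuse (label x)

  label′-surjective : ∀ i → ∃ λ d → label′ d ≡ i
  label′-surjective i with fuse-surjective i
  ... | l , refl with label-surjective l
  ...   | d , refl = d , refl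

  label′-invariant : ∀ x → label′ (π′ x) ≡ label′ x
  label′-invariant x = trans (transpose-invariant label′ fuse-identifies (π x)) (cong fuse (label-invariant x))

  label′-complete : ∀ {x y} → label′ x ≡ label′ y → SameOrbit π′ x y
  label′-complete {x} {y} eq with fuse-injective eq
  ... | inj₂ (fx , fy) = fused-sameOrbit fx fy
  ... | inj₁ lx≡ly with (label x ≟ label a) ⊎-dec (label x ≟ label b)
  ...   | yes fx  = fused-sameOrbit fx (subst Fused lx≡ly fx)
  ...   | no  ¬fx = sameOrbit-avoiding label label-invariant (¬fx ∘ inj₁) (¬fx ∘ inj₂) (label-complete lx≡ly)

  orbitLabelling : OrbitLabelling π′ c
  orbitLabelling = record
    { label            = label′
    ; label-surjective = label′-surjective
    ; label-invariant  = label′-invariant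
    ; label-complete   = label′-complete
    }

indicator : ∀ {P : Set} → Dec P → ℕ
indicator (yes _) = 1
indicator (no  _) = 0

indicator-cong : ∀ {P Q : Set} → (P → Q) → (Q → P) → (p : Dec P) (q : Dec Q) → indicator p ≡ indicator q
indicator-cong P→Q Q→P (yes _) (yes _) = refl
indicator-cong P→Q Q→P (yes p) (no ¬q) = ⊥-elim (¬q (P→Q p))
indicator-cong P→Q Q→P (no ¬p) (yes q) = ⊥-elim (¬p (Q→P q))
indicator-cong P→Q Q→P (no _)  (no _)  = refl

sum-const : ∀ n k → sum {n} (λ _ → k) ≡ n * k
sum-const zero    k = refl
sum-const (suc n) k = cong (k +_) (sum-const n k)

sum-ones : ∀ n → sum {n} (λ _ → 1) ≡ n
sum-ones n = trans (sum-const n 1) (*-identityʳ n)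

count-sum : ∀ {m} (P : Fin m → Set) (P? : ∀ i → Dec (P i)) → count P P? ≡ sum (λ i → indicator (P? i))
count-sum {zero}  P P? = refl
count-sum {suc m} P P? with P? zero
... | yes _ = cong suc (count-sum (P ∘ suc) (P? ∘ suc))
... | no  _ = count-sum (P ∘ suc) (P? ∘ suc)

indicator-yes : ∀ {P : Set} (p : Dec P) → P → indicator p ≡ 1
indicator-yes (yes _) _  = refl
indicator-yes (no ¬p) p = ⊥-elim (¬p p)

indicator-no : ∀ {P : Set} (p : Dec P) → ¬ P → indicator p ≡ 0
indicator-no (yes p) ¬p = ⊥-elim (¬p p)
indicator-no (no _)  _  = refl

count-unique : ∀ {m} {P : Fin m → Set} (P? : ∀ i → Dec (P i)) → (∀ {i j} → P i → P j → i ≡ j) →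
               count P P? ≡ indicator (any? P?)
count-unique {zero}  P? unique = refl
count-unique {suc m} {P} P? unique with P? zero
... | yes p₀ = cong suc none-after
  where
  none-after : count (P ∘ suc) (P? ∘ suc) ≡ 0
  none-after = trans (count-unique (P? ∘ suc) (λ p q → suc-injective (unique p q)))
                     (indicator-no (any? (P? ∘ suc)) (λ (i , pᵢ) → 0≢1+n (unique p₀ pᵢ)))
... | no ¬p₀ = trans (count-unique (P? ∘ suc) (λ p q → suc-injective (unique p q)))
                     (indicator-cong (λ (i , pᵢ) → suc i , pᵢ) shift (any? (P? ∘ suc)) _)
  where
  shift : ∃ P → ∃ (P ∘ suc)
  shift (zero  , p₀) = ⊥-elim (¬p₀ p₀)
  shift (suc i , pᵢ) = i , pᵢ

sum-indicator-unique : ∀ {m} {P : Fin m → Set} (P? : ∀ i → Dec (P i)) → (∀ {i j} → P i → P j → i ≡ j) →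
                       sum (λ i → indicator (P? i)) ≡ indicator (any? P?)
sum-indicator-unique P? unique = trans (sym (count-sum _ P?)) (count-unique P? unique)

count-complement : ∀ {c} {Q : Fin c → Set} (Q? : ∀ i → Dec (Q i)) →
                   count (λ v → ¬ Q v) (λ v → ¬? (Q? v)) + count Q Q? ≡ c
count-complement {c} {Q} Q? = begin
  count (λ v → ¬ Q v) (λ v → ¬? (Q? v)) + count Q Q?
    ≡⟨ cong₂ _+_ (count-sum _ (λ v → ¬? (Q? v))) (count-sum Q Q?) ⟩
  sum (λ v → indicator (¬? (Q? v))) + sum (λ v → indicator (Q? v))
    ≡⟨ ∑-distrib-+ (λ v → indicator (¬? (Q? v))) (λ v → indicator (Q? v)) ⟨
  sum (λ v → indicator (¬? (Q? v)) + indicator (Q? v))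
    ≡⟨ sum-cong-≗ one-of ⟩
  sum {c} (λ _ → 1)
    ≡⟨ sum-ones c ⟩
  c ∎
  where
  open ≡-Reasoning
  one-of : ∀ v → indicator (¬? (Q? v)) + indicator (Q? v) ≡ 1
  one-of v with Q? v
  ... | yes _ = refl
  ... | no  _ = refl

fibreSize : ∀ {m c} → (Fin m → Fin c) → Fin c → ℕ
fibreSize g v = count (λ d → g d ≡ v) (λ d → g d ≟ v)

sum-fibres : ∀ {m c} (g : Fin m → Fin c) → sum (fibreSize g) ≡ m
sum-fibres {m} g = begin
  sum (λ v → count (λ d → g d ≡ v) (λ d → g d ≟ v))
    ≡⟨ sum-cong-≗ (λ v → count-sum _ (λ d → g d ≟ v)) ⟩
  sum (λ v → sum (λ d → indicator (g d ≟ v)))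
    ≡⟨ ∑-comm (λ v d → indicator (g d ≟ v)) ⟩
  sum (λ d → sum (λ v → indicator (g d ≟ v)))
    ≡⟨ sum-cong-≗ (λ d → sum-indicator-unique (g d ≟_) (λ p q → trans (sym p) q)) ⟩
  sum (λ d → indicator (any? (g d ≟_)))
    ≡⟨ sum-cong-≗ (λ d → indicator-yes (any? (g d ≟_)) (g d , refl)) ⟩
  sum {m} (λ _ → 1)
    ≡⟨ sum-ones m ⟩
  m ∎
  where open ≡-Reasoning

sum-constant-except : ∀ {c} (h : Fin c → ℕ) (x : Fin c) k → (∀ v → v ≢ x → h v ≡ k) →
                      sum h + k ≡ h x + c * k
sum-constant-except {suc c} h zero k others = begin
  h zero + sum (h ∘ suc) + k        ≡⟨ +-assoc (h zero) _ k ⟩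
  h zero + (sum (h ∘ suc) + k)      ≡⟨ cong (λ s → h zero + (s + k)) (sum-cong-≗ (λ v → others (suc v) (λ ()))) ⟩
  h zero + (sum {c} (λ _ → k) + k)  ≡⟨ cong (λ s → h zero + (s + k)) (sum-const c k) ⟩
  h zero + (c * k + k)              ≡⟨ cong (h zero +_) (+-comm (c * k) k) ⟩
  h zero + suc c * k                ∎
  where open ≡-Reasoning
sum-constant-except {suc c} h (suc x) k others = begin
  h zero + sum (h ∘ suc) + k        ≡⟨ cong (λ s → s + sum (h ∘ suc) + k) (others zero (λ ())) ⟩
  k + sum (h ∘ suc) + k             ≡⟨ +-assoc k _ k ⟩
  k + (sum (h ∘ suc) + k)           ≡⟨ cong (k +_) (sum-constant-except (h ∘ suc) x k others′) ⟩
  k + (h (suc x) + c * k)           ≡⟨ x∙yz≈y∙xz k (h (suc x)) (c * k) ⟩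
  h (suc x) + suc c * k             ∎
  where
  open ≡-Reasoning
  others′ : ∀ v → v ≢ x → h (suc v) ≡ k
  others′ v v≢x = others (suc v) (v≢x ∘ suc-injective)

sum-fibreSizes : ∀ {m c} (g : Fin m → Fin c) (x : Fin c) {k l} → fibreSize g x ≡ l →
                 (∀ v → v ≢ x → fibreSize g v ≡ k) → m + k ≡ l + c * k
sum-fibreSizes {m} {c} g x {k} {l} at-x elsewhere = begin
  m + k                      ≡⟨ cong (_+ k) (sum-fibres g) ⟨
  sum (fibreSize g) + k      ≡⟨ sum-constant-except (fibreSize g) x k elsewhere ⟩
  fibreSize g x + c * k      ≡⟨ cong (_+ c * k) at-x ⟩
  l + c * k                  ∎
  where open ≡-Reasoning

-- Euler's inequality for maps

transposeAll : ∀ {m} → List (Fin m × Fin m) → Fin m → Fin m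
transposeAll []             z = z
transposeAll ((x , y) ∷ ps) z = transposeAll ps (transpose x y z)

transposeAll-injective : ∀ {m} (ps : List (Fin m × Fin m)) → Injective _≡_ _≡_ (transposeAll ps)
transposeAll-injective []             eq = eq
transposeAll-injective ((x , y) ∷ ps) eq = transpose-injective x y (transposeAll-injective ps eq)

Identifies : ∀ {m} {B : Set} → (Fin m → B) → Fin m × Fin m → Set
Identifies L (x , y) = L x ≡ L y

transposeAll-invariant : ∀ {m} {B : Set} (L : Fin m → B) (ps : List (Fin m × Fin m)) →
                         All (Identifies L) ps → ∀ z → L (transposeAll ps z) ≡ L z
transposeAll-invariant L []             All.[]             z = refl
transposeAll-invariant L ((x , y) ∷ ps) (Lx≡Ly All.∷ ids) z =
  trans (transposeAll-invariant L ps ids (transpose x y z)) (transpose-invariant L Lx≡Ly z)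

+-double-suc : ∀ n k → n + (suc k + suc k) ≡ suc (suc (n + (k + k)))
+-double-suc = solve-∀

MapConnected : ∀ {m} → (σ α : Fin m → Fin m) → Set
MapConnected {m} σ α = ∀ {K} (L : Fin m → Fin K) → (∀ d → L (σ d) ≡ L d) → (∀ d → L (α d) ≡ L d) →
                       ∀ d e → L d ≡ L e

module EulerBound {m} (σ : Fin m → Fin m) (σ-inj : Injective _≡_ _≡_ σ) {c₀} (σ-orbits : OrbitLabelling σ c₀) where

  ρ : List (Fin m × Fin m) → Fin m → Fin m
  ρ ps z = σ (transposeAll ps z)

  ρ-injective : ∀ ps → Injective _≡_ _≡_ (ρ ps)
  ρ-injective ps = transposeAll-injective ps ∘ σ-inj

  record ComponentLabelling (ps : List (Fin m × Fin m)) (K : ℕ) : Set where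
    field
      component            : Fin m → Fin K
      component-surjective : ∀ i → ∃ λ d → component d ≡ i
      component-σ          : ∀ d → component (σ d) ≡ component d
      component-identifies : All (Identifies component) ps

    component-ρ : ∀ d → component (ρ ps d) ≡ component d
    component-ρ d = trans (component-σ _) (transposeAll-invariant component ps component-identifies d)

  -- Euler's inequality for the partial map ρ ps, whose cycles are counted by c; K is at most
  -- its number of connected components.
  record Bounded (ps : List (Fin m × Fin m)) : Set where
    field
      {c K}      : ℕ
      ρ-orbits   : OrbitLabelling (ρ ps) c
      components : ComponentLabelling ps K
      bound      : c + c₀ ≤ length ps + (K + K)

  initial : Bounded []
  initial = record
    { ρ-orbits   = σ-orbits
    ; components = record
      { component            = label
      ; component-surjective = label-surjective
      ; component-σ          = label-invariant
      ; component-identifies = All.[]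
      }
    ; bound      = ≤-refl
    }
    where open OrbitLabelling σ-orbits

  module Extend {x y : Fin m} {ps : List (Fin m × Fin m)} (x≢y : x ≢ y) where

    open Transposed (ρ ps) (ρ-injective ps) (ρ ps x) (ρ ps y) using (π′)

    ρ-extended : π′ ≗ ρ ((x , y) ∷ ps)
    ρ-extended z = sym (transpose-conjugate (ρ-injective ps) x y z)

    ρx≢ρy : ρ ps x ≢ ρ ps y
    ρx≢ρy = x≢y ∘ ρ-injective ps

    join : ∀ {K} (C : ComponentLabelling ps K) → let open ComponentLabelling C in
           component x ≡ component y → ComponentLabelling ((x , y) ∷ ps) K
    join C cx≡cy = record
      { component            = component
      ; component-surjective = component-surjective
      ; component-σ          = component-σ
      ; component-identifies = cx≡cy All.∷ component-identifies
      }
      where open ComponentLabelling C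

    fuse : ∀ {K} (C : ComponentLabelling ps (suc K)) → let open ComponentLabelling C in
           component x ≢ component y → ComponentLabelling ((x , y) ∷ ps) K
    fuse C cx≢cy = record
      { component            = λ d → F.fuse (component d)
      ; component-surjective = surjective
      ; component-σ          = λ d → cong F.fuse (component-σ d)
      ; component-identifies = F.fuse-identifies All.∷ All.map (cong F.fuse) component-identifies
      }
      where
      open ComponentLabelling C
      module F = Fuse cx≢cy
      surjective : ∀ i → ∃ λ d → F.fuse (component d) ≡ i
      surjective i with F.fuse-surjective i
      ... | l , refl with component-surjective l
      ...   | d , refl = d , refl

    module _ {c K} (O : OrbitLabelling (ρ ps) c) (C : ComponentLabelling ps K) where
      open OrbitLabelling O
      open ComponentLabelling C

      split-orbit : label (ρ ps x) ≡ label (ρ ps y) → component x ≡ component y →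
                    c + c₀ ≤ length ps + (K + K) → Bounded ((x , y) ∷ ps)
      split-orbit same cx≡cy bnd = record
        { ρ-orbits   = orbitLabelling-≗ ρ-extended (Split.orbitLabelling (ρ ps) (ρ-injective ps) O ρx≢ρy same)
        ; components = join C cx≡cy
        ; bound      = s≤s bnd
        }

      apart-components : component x ≢ component y → label (ρ ps x) ≢ label (ρ ps y)
      apart-components cx≢cy same = cx≢cy (begin
        component x          ≡⟨ component-ρ x ⟨
        component (ρ ps x)   ≡⟨ sameOrbit-invariant component component-ρ (label-complete same) ⟩
        component (ρ ps y)   ≡⟨ component-ρ y ⟩
        component y          ∎)
        where open ≡-Reasoning

    merge-orbits : ∀ {c K} (O : OrbitLabelling (ρ ps) c) (C : ComponentLabelling ps K) →
                   let open OrbitLabelling O in let open ComponentLabelling C in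
                   label (ρ ps x) ≢ label (ρ ps y) → component x ≡ component y →
                   c + c₀ ≤ length ps + (K + K) → Bounded ((x , y) ∷ ps)
    merge-orbits {zero}  O C _ _ _ = ⊥-elim (¬Fin0 (OrbitLabelling.label O (ρ ps x)))
    merge-orbits {suc c} O C apart cx≡cy bnd = record
      { ρ-orbits   = orbitLabelling-≗ ρ-extended (Merge.orbitLabelling (ρ ps) (ρ-injective ps) O apart)
      ; components = join C cx≡cy
      ; bound      = m≤n⇒m≤1+n (≤-trans (n≤1+n _) bnd)
      }

    merge-components : ∀ {c K} (O : OrbitLabelling (ρ ps) c) (C : ComponentLabelling ps K) →
                       let open ComponentLabelling C in
                       component x ≢ component y → c + c₀ ≤ length ps + (K + K) → Bounded ((x , y) ∷ ps)
    merge-components {K = zero} O C _ _ = ⊥-elim (¬Fin0 (ComponentLabelling.component C x))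
    merge-components {zero} O C _ _ = ⊥-elim (¬Fin0 (OrbitLabelling.label O (ρ ps x)))
    merge-components {suc c} {suc K} O C cx≢cy bnd = record
      { ρ-orbits   = orbitLabelling-≗ ρ-extended
                       (Merge.orbitLabelling (ρ ps) (ρ-injective ps) O (apart-components O C cx≢cy))
      ; components = fuse C cx≢cy
      ; bound      = ≤-pred (≤-trans bnd (≤-reflexive (+-double-suc (length ps) K)))
      }

    extend : Bounded ps → Bounded ((x , y) ∷ ps)
    extend B = by-cases (component x ≟ component y) (label (ρ ps x) ≟ label (ρ ps y))
      where
      open Bounded B
      open ComponentLabelling components
      open OrbitLabelling ρ-orbits
      by-cases : Dec (component x ≡ component y) → Dec (label (ρ ps x) ≡ label (ρ ps y)) →
                 Bounded ((x , y) ∷ ps)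
      by-cases (yes cx≡cy) (yes same)  = split-orbit ρ-orbits components same cx≡cy bound
      by-cases (yes cx≡cy) (no  apart) = merge-orbits ρ-orbits components apart cx≡cy bound
      by-cases (no  cx≢cy) _           = merge-components ρ-orbits components cx≢cy bound

  bounded : ∀ ps → All (λ (x , y) → x ≢ y) ps → Bounded ps
  bounded []             All.[]          = initial
  bounded ((x , y) ∷ ps) (x≢y All.∷ ≢s) = Extend.extend x≢y (bounded ps ≢s)

module Matching {m} (α : Fin m → Fin m) (α-involutive : ∀ d → α (α d) ≡ d) (α-fixedPointFree : ∀ d → α d ≢ d) where

  -- Each pair {d, α d} is represented by its dart of smaller index.
  Low : Fin m → Set
  Low d = toℕ d < toℕ (α d)

  low? : ∀ d → Dec (Low d)
  low? d = toℕ d <? toℕ (α d)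

  low-asym : ∀ {d} → Low d → ¬ Low (α d)
  low-asym {d} d<αd αd<ααd = <-asym d<αd (subst (λ e → toℕ (α d) < toℕ e) (α-involutive d) αd<ααd)

  low-or-partner-low : ∀ d → Low d ⊎ Low (α d)
  low-or-partner-low d with <-cmp (toℕ d) (toℕ (α d))
  ... | tri< d<αd _ _ = inj₁ d<αd
  ... | tri≈ _ d≡αd _ = ⊥-elim (α-fixedPointFree d (sym (toℕ-injective d≡αd)))
  ... | tri> _ _ αd<d = inj₂ (subst (λ e → toℕ (α d) < toℕ e) (sym (α-involutive d)) αd<d)

  InPair : Fin m → Fin m → Set
  InPair u w = w ≡ u ⊎ w ≡ α u

  same-pair : ∀ {u v w} → InPair u w → InPair v w → v ≡ u ⊎ v ≡ α u
  same-pair (inj₁ refl) (inj₁ refl) = inj₁ refl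
  same-pair {u} {v} (inj₁ refl) (inj₂ u≡αv) = inj₂ (trans (sym (α-involutive v)) (cong α (sym u≡αv)))
  same-pair (inj₂ refl) (inj₁ refl) = inj₂ refl
  same-pair {u} {v} (inj₂ refl) (inj₂ αu≡αv) =
    inj₁ (trans (sym (α-involutive v)) (trans (cong α (sym αu≡αv)) (α-involutive u)))

  pairsFrom : ∀ {k} → (Fin k → Fin m) → List (Fin m × Fin m)
  pairsFrom {zero}  g = []
  pairsFrom {suc k} g with low? (g zero)
  ... | yes _ = (g zero , α (g zero)) ∷ pairsFrom (g ∘ suc)
  ... | no  _ = pairsFrom (g ∘ suc)

  pairsFrom-distinct : ∀ {k} (g : Fin k → Fin m) → All (λ (x , y) → x ≢ y) (pairsFrom g)
  pairsFrom-distinct {zero}  g = All.[]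
  pairsFrom-distinct {suc k} g with low? (g zero)
  ... | yes _ = (α-fixedPointFree (g zero) ∘ sym) All.∷ pairsFrom-distinct (g ∘ suc)
  ... | no  _ = pairsFrom-distinct (g ∘ suc)

  pairsFrom-length : ∀ {k} (g : Fin k → Fin m) → length (pairsFrom g) ≡ sum (λ i → indicator (low? (g i)))
  pairsFrom-length {zero}  g = refl
  pairsFrom-length {suc k} g with low? (g zero)
  ... | yes _ = cong suc (pairsFrom-length (g ∘ suc))
  ... | no  _ = pairsFrom-length (g ∘ suc)

  pairsFrom-identifies : ∀ {K} (L : Fin m → Fin K) {k} (g : Fin k → Fin m) → All (Identifies L) (pairsFrom g) →
                         ∀ i → Low (g i) → L (g i) ≡ L (α (g i))
  pairsFrom-identifies L {suc k} g ids i low with low? (g zero)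
  pairsFrom-identifies L g (id All.∷ ids) zero    low | yes _  = id
  pairsFrom-identifies L g (id All.∷ ids) (suc i) low | yes _  = pairsFrom-identifies L (g ∘ suc) ids i low
  pairsFrom-identifies L g ids        zero    low | no ¬lo = ⊥-elim (¬lo low)
  pairsFrom-identifies L g ids        (suc i) low | no _   = pairsFrom-identifies L (g ∘ suc) ids i low

  Covered : ∀ {k} → (Fin k → Fin m) → Fin m → Set
  Covered g z = ∃ λ i → Low (g i) × InPair (g i) z

  covered-shift : ∀ {k} {g : Fin (suc k) → Fin m} {z} → Covered (g ∘ suc) z → Covered g z
  covered-shift (i , low , p) = suc i , low , p

  covered-unshift : ∀ {k} (g : Fin (suc k) → Fin m) {z} → ¬ (Low (g zero) × InPair (g zero) z) →
                    Covered g z → Covered (g ∘ suc) z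
  covered-unshift g excluded (zero  , low , p) = ⊥-elim (excluded (low , p))
  covered-unshift g excluded (suc i , low , p) = i , low , p

  uncovered : ∀ {k} (g : Fin (suc k) → Fin m) → Injective _≡_ _≡_ g → Low (g zero) →
              ∀ {w} → InPair (g zero) w → ¬ Covered (g ∘ suc) w
  uncovered g g-inj low w∈ (i , low′ , w∈′) with same-pair w∈ w∈′
  ... | inj₁ eq = 0≢1+n (g-inj (sym eq))
  ... | inj₂ eq = low-asym low (subst Low eq low′)

  transposeAll-pairsFrom : ∀ {k} (g : Fin k → Fin m) → Injective _≡_ _≡_ g → ∀ z →
                           (Covered g z → transposeAll (pairsFrom g) z ≡ α z) ×
                           (¬ Covered g z → transposeAll (pairsFrom g) z ≡ z)
  transposeAll-pairsFrom {zero} g g-inj z = (λ ()) , (λ _ → refl)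
  transposeAll-pairsFrom {suc k} g g-inj z with low? (g zero)
  ... | no ¬low =
    (λ cov → proj₁ (rest z) (covered-unshift g (¬low ∘ proj₁) cov)) , (λ ¬cov → proj₂ (rest z) (¬cov ∘ covered-shift))
    where rest = transposeAll-pairsFrom (g ∘ suc) (suc-injective ∘ g-inj)
  ... | yes low with transpose (g zero) (α (g zero)) z | transpose-view (g zero) (α (g zero)) z
  ...   | _ | at-i refl =
    (λ _ → proj₂ (rest (α z)) (uncovered g g-inj low (inj₂ refl))) , (λ ¬cov → ⊥-elim (¬cov (zero , low , inj₁ refl)))
    where rest = transposeAll-pairsFrom (g ∘ suc) (suc-injective ∘ g-inj)
  ...   | _ | at-j refl =
    (λ _ → trans (proj₂ (rest (g zero)) (uncovered g g-inj low (inj₁ refl))) (sym (α-involutive (g zero))))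
    , (λ ¬cov → ⊥-elim (¬cov (zero , low , inj₂ refl)))
    where rest = transposeAll-pairsFrom (g ∘ suc) (suc-injective ∘ g-inj)
  ...   | _ | fixed z≢d z≢αd =
    (λ cov → proj₁ (rest z) (covered-unshift g (λ (_ , p) → [ z≢d , z≢αd ]′ p) cov))
    , (λ ¬cov → proj₂ (rest z) (¬cov ∘ covered-shift))
    where rest = transposeAll-pairsFrom (g ∘ suc) (suc-injective ∘ g-inj)

  pairs : List (Fin m × Fin m)
  pairs = pairsFrom (λ d → d)

  covered : ∀ z → Covered (λ d → d) z
  covered z with low-or-partner-low z
  ... | inj₁ low = z , low , inj₁ refl
  ... | inj₂ low = α z , low , inj₂ (sym (α-involutive z))

  transposeAll-pairs : ∀ z → transposeAll pairs z ≡ α z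
  transposeAll-pairs z = proj₁ (transposeAll-pairsFrom (λ d → d) (λ eq → eq) z) (covered z)

  identifies-pairs⇒α-invariant : ∀ {K} (L : Fin m → Fin K) → All (Identifies L) pairs → ∀ z → L (α z) ≡ L z
  identifies-pairs⇒α-invariant L ids z with low-or-partner-low z
  ... | inj₁ low = sym (pairsFrom-identifies L (λ d → d) ids z low)
  ... | inj₂ low = trans (pairsFrom-identifies L (λ d → d) ids (α z) low) (cong L (α-involutive z))

  pairs-length : length pairs + length pairs ≡ m
  pairs-length = begin
    length pairs + length pairs                       ≡⟨ cong₂ _+_ (pairsFrom-length (λ d → d))
                                                                  (trans (pairsFrom-length (λ d → d)) α-permutes) ⟩
    sum low-count + sum (λ d → low-count (α d))       ≡⟨ ∑-distrib-+ low-count (low-count ∘ α) ⟨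
    sum (λ d → low-count d + low-count (α d))         ≡⟨ sum-cong-≗ one-low ⟩
    sum {m} (λ _ → 1)                                 ≡⟨ sum-ones m ⟩
    m                                                 ∎
    where
    open ≡-Reasoning
    low-count : Fin m → ℕ
    low-count d = indicator (low? d)
    α-permutes : sum low-count ≡ sum (low-count ∘ α)
    α-permutes = sum-permute low-count (permutation α α α-involutive α-involutive)
    one-low : ∀ d → low-count d + low-count (α d) ≡ 1
    one-low d with low? d | low? (α d)
    ... | yes low | yes low′ = ⊥-elim (low-asym low low′)
    ... | yes _   | no  _    = refl
    ... | no  _   | yes _    = refl
    ... | no ¬low | no ¬low′ = ⊥-elim ([ ¬low , ¬low′ ]′ (low-or-partner-low d))

surjective-constant⇒≤1 : ∀ {m K} (L : Fin m → Fin K) → (∀ i → ∃ λ d → L d ≡ i) → (∀ d e → L d ≡ L e) → K ≤ 1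
surjective-constant⇒≤1 {K = zero}        L surj const = z≤n
surjective-constant⇒≤1 {K = suc zero}    L surj const = s≤s z≤n
surjective-constant⇒≤1 {K = suc (suc K)} L surj const with surj zero | surj (suc zero)
... | d , Ld≡0 | e , Le≡1 = ⊥-elim (0≢1+n (trans (sym Ld≡0) (trans (const d e) Le≡1)))

double-bound : ∀ {n f l K} → f + n ≤ l + (K + K) → K ≤ 1 → 2 * n + 2 * f ≤ (l + l) + 4
double-bound {n} {f} {l} {K} bnd K≤1 = begin
  2 * n + 2 * f          ≡⟨ regroup n f ⟩
  (f + n) + (f + n)      ≤⟨ +-mono-≤ half half ⟩
  (l + 2) + (l + 2)      ≡⟨ regroup′ l ⟩
  (l + l) + 4            ∎
  where
  open ≤-Reasoning
  half : f + n ≤ l + 2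
  half = ≤-trans bnd (+-monoʳ-≤ l (+-mono-≤ K≤1 K≤1))
  regroup : ∀ n f → 2 * n + 2 * f ≡ (f + n) + (f + n)
  regroup = solve-∀
  regroup′ : ∀ l → (l + 2) + (l + 2) ≡ (l + l) + 4
  regroup′ = solve-∀

euler-inequality : ∀ {m n f} {σ α : Fin m → Fin m} → Injective _≡_ _≡_ σ →
                   (∀ d → α (α d) ≡ d) → (∀ d → α d ≢ d) → MapConnected σ α →
                   OrbitLabelling σ n → OrbitLabelling (λ d → σ (α d)) f → 2 * n + 2 * f ≤ m + 4
euler-inequality {m} {n} {f} {σ} {α} σ-inj α-invol α-nofix connected vertices faces =
  subst (λ k → 2 * n + 2 * f ≤ k + 4) pairs-length
        (double-bound {n} {f} {length pairs} (subst (λ c → c + n ≤ length pairs + (K + K)) c≡f bound) K≤1)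
  where
  open Matching α α-invol α-nofix
  open EulerBound σ σ-inj vertices
  open Bounded (bounded pairs (pairsFrom-distinct (λ d → d)))
  open ComponentLabelling components
  c≡f = orbitCount-unique ρ-orbits (orbitLabelling-≗ (λ d → cong σ (sym (transposeAll-pairs d))) faces)
  K≤1 = surjective-constant⇒≤1 component component-surjective
          (connected component component-σ (identifies-pairs⇒α-invariant component component-identifies))

-- Faces of 2-connected plane graphs

module _ (G : PlaneGraph) where
  open PlaneGraph G

  α-injective : Injective _≡_ _≡_ α
  α-injective {d} {e} eq = trans (sym (α-invol d)) (trans (cong α eq) (α-invol e))

  φ-injective : Injective _≡_ _≡_ (λ d → σ (α d))
  φ-injective = α-injective ∘ σ-inj _ _

  vertexOrbits : OrbitLabelling σ n
  vertexOrbits = record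
    { label = tail ; label-surjective = tail-surj ; label-invariant = tail-σ ; label-complete = tail-orb _ _ }

  faceOrbits : OrbitLabelling (λ d → σ (α d)) f
  faceOrbits = record
    { label = face ; label-surjective = face-surj ; label-invariant = face-φ ; label-complete = face-orb _ _ }

  split-rotation-connected : TwoConnected G → ∀ {a b} → tail a ≡ tail b →
                             MapConnected (Transposed.π′ σ (σ-inj _ _) a b) α
  split-rotation-connected (_ , _ , avoiding-walk) {a} {b} same-vertex L L-σ′ L-α x y =
    connect (away-from-v x) (away-from-v y)
    where
    open Transposed σ (σ-inj _ _) a b
    v = tail a

    same-tail : ∀ {x y} → tail x ≡ tail y → tail x ≢ v → L x ≡ L y
    same-tail {x} {y} eq x≁v = sameOrbit-invariant L L-σ′
      (sameOrbit-avoiding tail tail-σ x≁v (λ x∼b → x≁v (trans x∼b (sym same-vertex))) (tail-orb x y eq))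

    along-walk : ∀ {u w} → ReachAvoid G v u w → u ≢ v → ∀ {x y} → tail x ≡ u → tail y ≡ w → L x ≡ L y
    along-walk here u≁v tx≡u ty≡w =
      same-tail (trans tx≡u (sym ty≡w)) (u≁v ∘ trans (sym tx≡u))
    along-walk (step d d′≁v walk) u≁v tx≡u ty≡w =
      trans (same-tail tx≡u (u≁v ∘ trans (sym tx≡u))) (trans (sym (L-α d)) (along-walk walk d′≁v refl ty≡w))

    Represented : Fin m → Set
    Represented x = ∃ λ x′ → tail x′ ≢ v × L x ≡ L x′

    away-from-v : ∀ x → Represented x
    away-from-v x with tail x ≟ v
    ... | yes x∼v = α x , (λ αx∼v → noLoop x (trans αx∼v (sym x∼v))) , sym (L-α x)
    ... | no  x≁v = x , x≁v , refl

    connect : ∀ {x y} → Represented x → Represented y → L x ≡ L y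
    connect {x} {y} (x′ , x′≁v , Lx≡Lx′) (y′ , y′≁v , Ly≡Ly′) = begin
      L x  ≡⟨ Lx≡Lx′ ⟩
      L x′ ≡⟨ along-walk (avoiding-walk v (tail x′) (tail y′) x′≁v y′≁v) x′≁v refl refl ⟩
      L y′ ≡⟨ Ly≡Ly′ ⟨
      L y  ∎
      where open ≡-Reasoning

  face-visits-vertex-once : TwoConnected G → ∀ {d e} → face d ≡ face e → tail d ≡ tail e → d ≡ e
  face-visits-vertex-once tc {d} {e} same-face same-vertex with d ≟ e
  ... | yes d≡e = d≡e
  ... | no  d≢e = ⊥-elim (m+1+n≰m (2 * n + 2 * f) (subst₂ _≤_ (regroup n f) (sym euler) too-many))
    where
    open Transposed σ (σ-inj _ _) d e using (π′; π′-injective)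
    split-vertices : OrbitLabelling π′ (suc n)
    split-vertices = Split.orbitLabelling σ (σ-inj _ _) vertexOrbits d≢e same-vertex
    split-faces : OrbitLabelling (λ x → π′ (α x)) (suc f)
    split-faces = Split.orbitLabelling (λ x → σ (α x)) φ-injective faceOrbits d≢e same-face
    regroup : ∀ n f → 2 * suc n + 2 * suc f ≡ (2 * n + 2 * f) + 4
    regroup = solve-∀
    too-many : 2 * suc n + 2 * suc f ≤ m + 4
    too-many = euler-inequality π′-injective α-invol α-nofix (split-rotation-connected tc same-vertex)
                                split-vertices split-faces

module _ (G : PlaneGraph) (two-connected : TwoConnected G) where
  open PlaneGraph G

  boundary-size : ∀ F → count (λ v → OnBoundary G v F) (λ v → onBoundary? G v F) ≡ fdeg G F
  boundary-size F = begin
    count (λ v → OnBoundary G v F) (λ v → onBoundary? G v F)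
      ≡⟨ count-sum _ (λ v → onBoundary? G v F) ⟩
    sum (λ v → indicator (onBoundary? G v F))
      ≡⟨ sum-cong-≗ (λ v → sum-indicator-unique (P? v) unique) ⟨
    sum (λ v → sum (λ d → indicator (P? v d)))
      ≡⟨ ∑-comm (λ v d → indicator (P? v d)) ⟩
    sum (λ d → sum (λ v → indicator (P? v d)))
      ≡⟨ sum-cong-≗ (λ d → sum-indicator-unique (λ v → P? v d) tail-unique) ⟩
    sum (λ d → indicator (any? (λ v → P? v d)))
      ≡⟨ sum-cong-≗ (λ d → indicator-cong (proj₁ ∘ proj₂) (λ p → tail d , p , refl) _ (face d ≟ F)) ⟩
    sum (λ d → indicator (face d ≟ F))
      ≡⟨ count-sum _ (λ d → face d ≟ F) ⟨
    fdeg G F ∎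
    where
    open ≡-Reasoning
    P? : ∀ v d → Dec (face d ≡ F × tail d ≡ v)
    P? v d = (face d ≟ F) ×-dec (tail d ≟ v)
    unique : ∀ {v d e} → face d ≡ F × tail d ≡ v → face e ≡ F × tail e ≡ v → d ≡ e
    unique (fd , td) (fe , te) = face-visits-vertex-once G two-connected (trans fd (sym fe)) (trans td (sym te))
    tail-unique : ∀ {d v w} → face d ≡ F × tail d ≡ v → face d ≡ F × tail d ≡ w → v ≡ w
    tail-unique (_ , td) (_ , td′) = trans (sym td) td′

  interior-size : ∀ F → notOnBoundaryCount G F + fdeg G F ≡ n
  interior-size F = trans (cong (notOnBoundaryCount G F +_) (sym (boundary-size F)))
                          (count-complement (λ v → onBoundary? G v F))

-- The multipliers a₁ … a₄ are a certificate that c * x ≡ c * y is a linear consequence of the hypotheses.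
linear-combination : ∀ c a₁ a₂ a₃ a₄ .{{_ : NonZero c}} {x y L₁ R₁ L₂ R₂ L₃ R₃ L₄ R₄} →
                     L₁ ≡ R₁ → L₂ ≡ R₂ → L₃ ≡ R₃ → L₄ ≡ R₄ →
                     c * x + (a₁ * R₁ + a₂ * R₂ + a₃ * R₃ + a₄ * R₄) ≡ c * y + (a₁ * L₁ + a₂ * L₂ + a₃ * L₃ + a₄ * L₄) →
                     x ≡ y
linear-combination c _ _ _ _ {x} {y} refl refl refl refl eq = *-cancelˡ-≡ x y c (+-cancelʳ-≡ _ _ _ eq)

module InteriorCount (t d n f m : ℕ) (euler : 2 * n + 2 * f ≡ m + 4) (interior : t + d ≡ n) where

  interior-3-3-2 : m + 3 ≡ 2 + n * 3 → m + 3 ≡ d + f * 3 → 3 * t + d ≡ 5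
  interior-3-3-2 vertices faces = linear-combination 1 1 2 3 3 vertices faces euler interior
                                    (solve (t ∷ d ∷ n ∷ f ∷ m ∷ []))

  interior-3-4-2 : m + 3 ≡ 2 + n * 3 → m + 4 ≡ d + f * 4 → t ≡ 3
  interior-3-4-2 vertices faces = linear-combination 1 1 1 2 1 vertices faces euler interior
                                    (solve (t ∷ d ∷ n ∷ f ∷ m ∷ []))

  interior-3-5-2 : m + 3 ≡ 2 + n * 3 → m + 5 ≡ d + f * 5 → t ≡ d + 7
  interior-3-5-2 vertices faces = linear-combination 1 3 2 5 1 vertices faces euler interior
                                    (solve (t ∷ d ∷ n ∷ f ∷ m ∷ []))

  interior-4-3-2 : m + 4 ≡ 2 + n * 4 → m + 3 ≡ d + f * 3 → t ≡ 2
  interior-4-3-2 vertices faces = linear-combination 2 1 2 3 2 vertices faces euler interior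
                                    (solve (t ∷ d ∷ n ∷ f ∷ m ∷ []))

  interior-5-3-2 : m + 5 ≡ 2 + n * 5 → m + 3 ≡ d + f * 3 → t ≡ d + 3
  interior-5-3-2 vertices faces = linear-combination 1 1 2 3 1 vertices faces euler interior
                                    (solve (t ∷ d ∷ n ∷ f ∷ m ∷ []))

  interior-5-3-3 : m + 5 ≡ 3 + n * 5 → m + 3 ≡ d + f * 3 → t ≡ d + 4
  interior-5-3-3 vertices faces = linear-combination 1 1 2 3 1 vertices faces euler interior
                                    (solve (t ∷ d ∷ n ∷ f ∷ m ∷ []))

  interior-5-3-4 : m + 5 ≡ 4 + n * 5 → m + 3 ≡ d + f * 3 → t ≡ d + 5
  interior-5-3-4 vertices faces = linear-combination 1 1 2 3 1 vertices faces euler interior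
                                    (solve (t ∷ d ∷ n ∷ f ∷ m ∷ []))

lemma11 : (G : PlaneGraph) (k d₁ d l : ℕ)
    (x₁ : Fin (PlaneGraph.n G)) (Fe : Fin (PlaneGraph.f G)) →
    IsEndblock G k d₁ d l x₁ Fe →
    let t = notOnBoundaryCount G Fe in
    (k ≡ 3 → d₁ ≡ 3 → l ≡ 2 → 3 * t + d ≡ 5) ×
    (k ≡ 3 → d₁ ≡ 4 → l ≡ 2 → t ≡ 3) ×
    (k ≡ 3 → d₁ ≡ 5 → l ≡ 2 → t ≡ d + 7) ×
    (k ≡ 4 → d₁ ≡ 3 → l ≡ 2 → t ≡ 2) ×
    (k ≡ 5 → d₁ ≡ 3 → l ≡ 2 → t ≡ d + 3) ×
    (k ≡ 5 → d₁ ≡ 3 → l ≡ 3 → t ≡ d + 4) ×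
    (k ≡ 5 → d₁ ≡ 3 → l ≡ 4 → t ≡ d + 5)
lemma11 G k d₁ d l x₁ Fe (two-connected , _ , deg-x₁ , deg-others , deg-Fe , deg-faces , _ , _) =
  (λ { refl refl refl → interior-3-3-2 vertices faces }) ,
  (λ { refl refl refl → interior-3-4-2 vertices faces }) ,
  (λ { refl refl refl → interior-3-5-2 vertices faces }) ,
  (λ { refl refl refl → interior-4-3-2 vertices faces }) ,
  (λ { refl refl refl → interior-5-3-2 vertices faces }) ,
  (λ { refl refl refl → interior-5-3-3 vertices faces }) ,
  (λ { refl refl refl → interior-5-3-4 vertices faces })
  where
  open PlaneGraph G
  vertices = sum-fibreSizes tail x₁ deg-x₁ deg-others
  faces    = sum-fibreSizes face Fe deg-Fe deg-faces
  interior = subst (λ d → notOnBoundaryCount G Fe + d ≡ n) deg-Fe (interior-size G two-connected Fe)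
  open InteriorCount (notOnBoundaryCount G Fe) d n f m euler interior
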